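{- There is a co-meager semifilter $\mathcal S$ on $\omega$ such that no ultrafilter on $\mathcal S$ is a $P$-filter.
   Context: For $A,B\subseteq\omega$, $A\subseteq^* B$ means $A\setminus B$ is finite. A semifilter on $\omega$ is a set $\mathcal S\subseteq\mathcal P(\omega)$ with $\emptyset\neq\mathcal S\neq\mathcal P(\omega)$ closed upwards under $\subseteq^*$; subsets of $\omega$ are identified with points of $2^\omega$ and co-meager refers to that topology. A filter on $\mathcal S$ is a nonempty $\mathcal F\subseteq\mathcal S$ closed upwards under $\subseteq^*$ and under finite intersections; an ultrafilter on $\mathcal S$ is a maximal filter on $\mathcal S$. A filter $\mathcal F$ is a $P$-filter if its Stone dual $\bigcap_{A\in\mathcal F}A^*$ is a $P$-set in $\omega^*$ (the space of free ultrafilters on $\omega$, with basic open sets $A^*=\{p:A\in p\}$), where $X\subseteq\omega^*$ is a $P$-set if for every sequence of open $U_n\supseteq X$, $X$ lies in the interior of $\bigcap_n U_n$; equivalently, every countable subfamily of $\mathcal F$ has a $\subseteq^*$-lower bound in $\mathcal F$. -}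

module Defs where

open import Data.Nat using (ℕ; _≤_; _<_)
open import Data.Bool using (Bool; true; false; _∧_)
open import Data.Product using (Σ; _×_; ∃)
open import Relation.Binary.PropositionalEquality using (_≡_)
open import Relation.Nullary using (¬_)
open import Level using (suc; zero)

-- Subsets of ω, identified with points of Cantor space 2^ω.
Subset : Set
Subset = ℕ → Bool

-- A ⊆* B : A ∖ B is finite (i.e. bounded).
_⊆*_ : Subset → Subset → Set
A ⊆* B = ∃ λ N → ∀ n → N ≤ n → A n ≡ true → B n ≡ true

_∩_ : Subset → Subset → Subset
(A ∩ B) n = A n ∧ B n

Family : Set₁
Family = Subset → Set

_⊑_ : Family → Family → Set
F ⊑ G = ∀ A → F A → G A

record Semifilter (S : Family) : Set where
  field
    nonempty  : ∃ λ A → S A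
    proper    : ∃ λ A → ¬ S A
    upward    : ∀ A B → S A → A ⊆* B → S B

Agree : ℕ → Subset → Subset → Set
Agree n x y = ∀ i → i < n → x i ≡ y i

IsOpen : Family → Set
IsOpen U = ∀ x → U x → ∃ λ n → ∀ y → Agree n x y → U y

IsDense : Family → Set
IsDense U = ∀ x n → ∃ λ y → Agree n x y × U y

CoMeager : Family → Set₁
CoMeager S = Σ (ℕ → Family) λ U →
  (∀ k → IsOpen (U k)) × (∀ k → IsDense (U k)) × (∀ x → (∀ k → U k x) → S x)

record FilterOn (S : Family) (F : Family) : Set where
  field
    sub       : F ⊑ S
    nonempty  : ∃ λ A → F A
    upward    : ∀ A B → F A → A ⊆* B → F B
    intersect : ∀ A B → F A → F B → F (A ∩ B)

record UltrafilterOn (S : Family) (F : Family) : Set₁ where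
  field
    filter  : FilterOn S F
    maximal : ∀ G → FilterOn S G → F ⊑ G → G ⊑ F

-- P-filter (combinatorial form): every countable subfamily has a
-- ⊆*-lower bound in F.
PFilter : Family → Set
PFilter F = ∀ (A : ℕ → Subset) → (∀ n → F (A n)) →
  ∃ λ B → F B × (∀ n → B ⊆* A n)

-- Identify ω with ω × ω via the diagonal enumeration, so that every
-- index i lies in the column  col i  at height  row i.  The semifilter is
--     𝒮 = { A | A has infinite intersection with infinitely many columns }.
-- It is closed upwards under ⊆*, contains ω and omits ∅; it is co-meager
-- since it contains the intersection of the dense open sets
--     U k = { A | A meets column (col k) at an index ≥ row k }.
-- Let Xₖ be the union of the columns ≥ k.  If A ∈ 𝒮 then A ∩ Xₖ ∈ 𝒮, and
-- a general fact about maximal filters (a set meeting every member of an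
-- ultrafilter on 𝒮 inside 𝒮 belongs to it) puts every Xₖ into every
-- ultrafilter on 𝒮.  A P-filter would then contain a common ⊆*-lower
-- bound B of all Xₖ; but B ∈ 𝒮 has an infinite column n, so B ⊈* Xₙ₊₁.
module Submission where

open import Defs
open import Data.Product using (Σ; _×_)
open import Relation.Nullary using (¬_)

open import Data.Nat using (ℕ; zero; suc; _+_; _≤_; _≤ᵇ_; z≤n; s≤s)
open import Data.Nat.Properties
  using (≤-refl; ≤-trans; <⇒≱; m≤m+n; m≤n+m; n≤1+n; +-identityʳ;
         +-suc; suc-injective; _<?_; ≤⇒≤ᵇ; ≤ᵇ⇒≤)
open import Data.Bool using (true; false; _∧_)
open import Data.Bool.Properties using (∧-conicalˡ; ∧-conicalʳ; T-≡)
open import Data.Empty using (⊥-elim)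
open import Data.Product using (_,_; proj₁; proj₂; ∃)
open import Function.Bundles using (Equivalence)
open import Relation.Binary.PropositionalEquality using (_≡_; refl; sym; trans; cong; cong₂; subst)
open import Relation.Nullary using (yes; no)

step : ℕ × ℕ → ℕ × ℕ
step (n , zero)  = (zero , suc n)
step (n , suc m) = (suc n , m)

cell : ℕ → ℕ × ℕ
cell zero    = (zero , zero)
cell (suc k) = step (cell k)

col row : ℕ → ℕ
col k = proj₁ (cell k)
row k = proj₂ (cell k)

step-diagonal : ∀ p k → proj₁ p + proj₂ p ≤ k → proj₁ (step p) + proj₂ (step p) ≤ suc k
step-diagonal (n , zero)  k h = s≤s (subst (_≤ k) (+-identityʳ n) h)
step-diagonal (n , suc m) k h = ≤-trans (subst (_≤ k) (+-suc n m) h) (n≤1+n k)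

cell-diagonal : ∀ k → col k + row k ≤ k
cell-diagonal zero    = z≤n
cell-diagonal (suc k) = step-diagonal (cell k) k (cell-diagonal k)

row≤index : ∀ k → row k ≤ k
row≤index k = ≤-trans (m≤n+m (row k) (col k)) (cell-diagonal k)

cell-onto : ∀ n m → ∃ λ k → cell k ≡ (n , m)
cell-onto n m = onDiagonal (n + m) n m refl
  where
  onDiagonal : ∀ s n m → n + m ≡ s → ∃ λ k → cell k ≡ (n , m)
  onDiagonal zero    zero    zero    _  = zero , refl
  onDiagonal (suc s) zero    (suc m) eq with onDiagonal s m zero (trans (+-identityʳ m) (suc-injective eq))
  ... | k , p = suc k , cong step p
  onDiagonal s       (suc n) m       eq with onDiagonal s n (suc m) (trans (+-suc n m) eq)
  ... | k , p = suc k , cong step p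

column-unbounded : ∀ n M → ∃ λ i → col i ≡ n × M ≤ i
column-unbounded n M with cell-onto n M
... | i , eq = i , cong proj₁ eq , subst (_≤ i) (cong proj₂ eq) (row≤index i)

⊆*-refl : ∀ {A} → A ⊆* A
⊆*-refl = 0 , λ _ _ a → a

⊆*-trans : ∀ {A B C} → A ⊆* B → B ⊆* C → A ⊆* C
⊆*-trans (N , f) (N' , g) =
  N + N' , λ n le a → g n (≤-trans (m≤n+m N' N) le) (f n (≤-trans (m≤m+n N N') le) a)

∩-lowerˡ : ∀ {A B} → (A ∩ B) ⊆* A
∩-lowerˡ {A} = 0 , λ n _ → ∧-conicalˡ (A n) _

∩-lowerʳ : ∀ {A B} → (A ∩ B) ⊆* B
∩-lowerʳ {A} = 0 , λ n _ → ∧-conicalʳ (A n) _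

∩-greatest : ∀ {A B C} → C ⊆* A → C ⊆* B → C ⊆* (A ∩ B)
∩-greatest (N , f) (N' , g) =
  N + N' , λ n le c → cong₂ _∧_ (f n (≤-trans (m≤m+n N N') le) c) (g n (≤-trans (m≤n+m N' N) le) c)

∩-mono : ∀ {A A' B B'} → A ⊆* A' → B ⊆* B' → (A ∩ B) ⊆* (A' ∩ B')
∩-mono p q = ∩-greatest (⊆*-trans ∩-lowerˡ p) (⊆*-trans ∩-lowerʳ q)

-- The upward closure required of a semifilter, the only property of 𝒮
-- that the absorption lemma uses.
UpwardClosed : Family → Set
UpwardClosed S = ∀ A B → S A → A ⊆* B → S B

-- If Y meets every member of the ultrafilter F on S in a member of S,
-- then F ∪ {Y} generates a filter on S, so Y ∈ F by maximality.
ultrafilter-absorbs : ∀ {S F} → UpwardClosed S → UltrafilterOn S F →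
  ∀ Y → (∀ A → F A → S (A ∩ Y)) → F Y
ultrafilter-absorbs {S} {F} up uf Y meets =
  UltrafilterOn.maximal uf G G-filter F⊑G Y (A₀ , FA₀ , ∩-lowerʳ)
  where
  module 𝓕 = FilterOn (UltrafilterOn.filter uf)
  A₀ = proj₁ 𝓕.nonempty
  FA₀ = proj₂ 𝓕.nonempty

  G : Family
  G Z = ∃ λ A → F A × (A ∩ Y) ⊆* Z

  G-filter : FilterOn S G
  G-filter = record
    { sub       = λ Z (A , FA , s) → up (A ∩ Y) Z (meets A FA) s
    ; nonempty  = A₀ ∩ Y , A₀ , FA₀ , ⊆*-refl
    ; upward    = λ Z W (A , FA , s) t → A , FA , ⊆*-trans s t
    ; intersect = λ Z W (A , FA , s) (A' , FA' , s') →
        A ∩ A' , 𝓕.intersect A A' FA FA' ,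
        ∩-greatest (⊆*-trans (∩-mono (∩-lowerˡ {A} {A'}) (⊆*-refl {Y})) s)
                   (⊆*-trans (∩-mono (∩-lowerʳ {A} {A'}) (⊆*-refl {Y})) s')
    }

  F⊑G : F ⊑ G
  F⊑G A FA = A , FA , ∩-lowerˡ

MeetsColumnBeyond : Subset → ℕ → ℕ → Set
MeetsColumnBeyond A n M = ∃ λ i → col i ≡ n × M ≤ i × A i ≡ true

InfiniteColumn : Subset → ℕ → Set
InfiniteColumn A n = ∀ M → MeetsColumnBeyond A n M

𝒮 : Family
𝒮 A = ∀ N → ∃ λ n → N ≤ n × InfiniteColumn A n

infiniteColumn-⊆* : ∀ {A B n} → A ⊆* B → InfiniteColumn A n → InfiniteColumn B n
infiniteColumn-⊆* (N₀ , sub) inf M with inf (M + N₀)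
... | i , ci , le , Ai = i , ci , ≤-trans (m≤m+n M N₀) le , sub i (≤-trans (m≤n+m N₀ M) le) Ai

𝒮-upward : UpwardClosed 𝒮
𝒮-upward A B SA A⊆*B N with SA N
... | n , N≤n , inf = n , N≤n , infiniteColumn-⊆* A⊆*B inf

𝒮-semifilter : Semifilter 𝒮
𝒮-semifilter = record
  { nonempty = (λ _ → true) , λ N → N , ≤-refl , full N
  ; proper   = (λ _ → false) , empty
  ; upward   = 𝒮-upward
  }
  where
  full : ∀ n → InfiniteColumn (λ _ → true) n
  full n M with column-unbounded n M
  ... | i , ci , M≤i = i , ci , M≤i , refl
  empty : ¬ 𝒮 (λ _ → false)
  empty S∅ with S∅ 0
  ... | _ , _ , inf with inf 0
  ... | _ , _ , _ , ()

U : ℕ → Family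
U k A = MeetsColumnBeyond A (col k) (row k)

U-open : ∀ k → IsOpen (U k)
U-open k x (i , ci , le , xi) = suc i , λ y agree → i , ci , le , trans (sym (agree i ≤-refl)) xi

patch : ℕ → Subset → Subset
patch n₀ x j with j <? n₀
... | yes _ = x j
... | no _  = true

patch-agrees : ∀ n₀ x → Agree n₀ x (patch n₀ x)
patch-agrees n₀ x j j<n₀ with j <? n₀
... | yes _   = refl
... | no j≮n₀ = ⊥-elim (j≮n₀ j<n₀)

patch-beyond : ∀ n₀ x j → n₀ ≤ j → patch n₀ x j ≡ true
patch-beyond n₀ x j n₀≤j with j <? n₀
... | yes j<n₀ = ⊥-elim (<⇒≱ j<n₀ n₀≤j)
... | no _     = refl

U-dense : ∀ k → IsDense (U k)
U-dense k x n₀ with column-unbounded (col k) (row k + n₀)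
... | i , ci , le =
  patch n₀ x , patch-agrees n₀ x ,
  i , ci , ≤-trans (m≤m+n (row k) n₀) le , patch-beyond n₀ x i (≤-trans (m≤n+m n₀ (row k)) le)

-- Meeting every U k means meeting every column at arbitrary heights.
⋂U⊆𝒮 : ∀ x → (∀ k → U k x) → 𝒮 x
⋂U⊆𝒮 x inU N = N , ≤-refl , λ M → hit (cell-onto N M)
  where
  hit : ∀ {N M} → (∃ λ k → cell k ≡ (N , M)) → MeetsColumnBeyond x N M
  hit (k , refl) = inU k

𝒮-comeager : CoMeager 𝒮
𝒮-comeager = U , U-open , U-dense , ⋂U⊆𝒮

X : ℕ → Subset
X k i = k ≤ᵇ col i

X-intro : ∀ {k i} → k ≤ col i → X k i ≡ true
X-intro k≤c = Equivalence.to T-≡ (≤⇒≤ᵇ k≤c)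

X-elim : ∀ {k i} → X k i ≡ true → k ≤ col i
X-elim {k} {i} Xki = ≤ᵇ⇒≤ k (col i) (Equivalence.from T-≡ Xki)

-- Columns from k on are untouched by intersecting with Xₖ.
𝒮-tail : ∀ A k → 𝒮 A → 𝒮 (A ∩ X k)
𝒮-tail A k SA N with SA (N + k)
... | n , le , inf = n , ≤-trans (m≤m+n N k) le , restrict
  where
  restrict : InfiniteColumn (A ∩ X k) n
  restrict M with inf M
  ... | i , ci , M≤i , Ai =
    i , ci , M≤i , cong₂ _∧_ Ai (X-intro {k} {i} (subst (k ≤_) (sym ci) (≤-trans (m≤n+m k N) le)))

tails-in-ultrafilters : ∀ F → UltrafilterOn 𝒮 F → ∀ k → F (X k)
tails-in-ultrafilters F uf k =
  ultrafilter-absorbs 𝒮-upward uf (X k)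
    (λ A FA → 𝒮-tail A k (FilterOn.sub (UltrafilterOn.filter uf) A FA))

tails-no-lower-bound : ∀ B → 𝒮 B → ¬ (∀ k → B ⊆* X k)
tails-no-lower-bound B SB below with SB 0
... | n , _ , inf with below (suc n)
... | N₀ , sub with inf N₀
... | i , ci , N₀≤i , Bi = <⇒≱ (subst (suc n ≤_) ci (X-elim {suc n} {i} (sub i N₀≤i Bi))) ≤-refl

mainTheorem11 : Σ Family λ S →
    Semifilter S × CoMeager S × (∀ F → UltrafilterOn S F → ¬ PFilter F)
mainTheorem11 = 𝒮 , 𝒮-semifilter , 𝒮-comeager , noPFilter
  where
  noPFilter : ∀ F → UltrafilterOn 𝒮 F → ¬ PFilter F
  noPFilter F uf isP with isP X (tails-in-ultrafilters F uf)
  ... | B , FB , B⊆*tails =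
    tails-no-lower-bound B (FilterOn.sub (UltrafilterOn.filter uf) B FB) B⊆*tails
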